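{- Let $q$ be a prime power, let $n$ and $m\ge3$ be positive integers, and let $I,J$ be nonnegative integers with $I<J<n$; put $K:=J-I$ and $C_{h,\ell}:=\frac{q^{h\ell}-1}{q^h-1}$. Let $\alpha_1,\dots,\alpha_m\in\mathbb{F}_{q^n}^*$, $\mathbf{A}=(\alpha_1,\dots,\alpha_m)$. Assume $\gcd(I,J)=1$ and that $$K^{I,J}_{\mathbf{A}}:=\frac{\alpha_3\,\alpha_4^{q^K}\cdots\alpha_m^{q^{(m-3)K}}\,\alpha_1^{q^{(m-2)K}}}{\alpha_2^{C_{K,m-1}}}$$ is not a $C_{K,m}$-power in $\mathbb{F}_{q^n}$. Then $U^{I,J}_{\mathbf{A}}$ is exceptional scattered, i.e. for infinitely many positive integers $\ell$ the $\mathbb{F}_q$-subspace $$U^{I,J}_{\mathbf{A},\ell}:=\{(x_1,\dots,x_m,f_1(\underline{x}),\dots,f_m(\underline{x})) : x_1,\dots,x_m\in\mathbb{F}_{q^{n\ell}}\}\subseteq\mathbb{F}_{q^{n\ell}}^{2m}$$ is scattered, where $f_i(\underline{x})=x_i^{q^I}+\alpha_{i+1}x_{i+1}^{q^J}$ ($i=1,\dots,m-1$) and $f_m(\underline{x})=x_m^{q^I}+\alpha_1x_1^{q^J}$.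
   Context: An element $a$ of a field $F$ is a $d$-power in $F$ if $a=y^d$ for some $y\in F$. An $\mathbb{F}_q$-subspace $U$ of $\mathbb{F}_{Q}^k$ ($Q$ a power of $q$) is scattered if $\dim_{\mathbb{F}_q}(U\cap\langle v\rangle_{\mathbb{F}_{Q}})\le 1$ for every $v\in\mathbb{F}_{Q}^k$. The case $\ell=1$ gives the set $U^{I,J}_{\mathbf{A}}\subseteq\mathbb{F}_{q^n}^{2m}$. -}

module Defs where

open import Level using (0ℓ)
open import Data.Nat using (ℕ; zero; suc; _≤_; NonZero)
import Data.Nat as N
open import Data.Nat.DivMod using (_mod_)
open import Data.Fin using (Fin; splitAt; toℕ)
open import Data.Sum using (_⊎_; inj₁; inj₂; [_,_]′)
open import Data.Product using (Σ; ∃; _×_; _,_)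
open import Relation.Nullary using (¬_)
open import Relation.Binary.PropositionalEquality using (_≡_)
open import Algebra.Bundles using (CommutativeRing)
import Algebra.Bundles
import Algebra.Definitions.RawSemiring as RS
open import Algebra.Morphism.Structures using (module RingMorphisms)

record FiniteField : Set₁ where
  field
    ring : CommutativeRing 0ℓ 0ℓ
  open CommutativeRing ring public hiding (ring)
  field
    1≉0      : ¬ (1# ≈ 0#)
    _⁻¹      : Carrier → Carrier
    inverseʳ : ∀ x → ¬ (x ≈ 0#) → (x * (x ⁻¹)) ≈ 1#
    size     : ℕ
    enum     : Fin size → Carrier
    enum-inj : ∀ i j → enum i ≈ enum j → i ≡ j
    enum-sur : ∀ x → ∃ λ i → enum i ≈ x
  open RS (Algebra.Bundles.Semiring.rawSemiring semiring) public using () renaming (_^_ to _^F_)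

open import Data.Nat.Primality using (Prime)
IsPrimePower : ℕ → Set
IsPrimePower q = Σ ℕ λ p → Σ ℕ λ e → Prime p × (1 ≤ e) × (q ≡ p N.^ e)

-- C_{h,ℓ} = (q^{hℓ} - 1)/(q^h - 1) = Σ_{i<ℓ} q^{h i}
C : (q h ℓ : ℕ) → ℕ
C q h zero    = 0
C q h (suc ℓ) = q N.^ (h N.* ℓ) N.+ C q h ℓ

IsFieldHom : (F E : FiniteField) → (FiniteField.Carrier F → FiniteField.Carrier E) → Set
IsFieldHom F E ι = RingMorphisms.IsRingHomomorphism
  (CommutativeRing.rawRing (FiniteField.ring F)) (CommutativeRing.rawRing (FiniteField.ring E)) ι

module _ (F : FiniteField) where
  open FiniteField F

  IsPower : ℕ → Carrier → Set
  IsPower d a = ∃ λ y → (y ^F d) ≈ a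

  prod : ℕ → (ℕ → Carrier) → Carrier
  prod zero    g = 1#
  prod (suc k) g = prod k g * g k

  InFq : ℕ → Carrier → Set
  InFq q a = (a ^F q) ≈ a

  -- An F_q-subspace U of F^N (given as a predicate) is scattered:
  -- for every v, dim_{F_q}(U ∩ ⟨v⟩_F) ≤ 1, i.e. any two elements of U ∩ ⟨v⟩_F
  -- are F_q-linearly dependent.
  Scattered : (q N : ℕ) → ((Fin N → Carrier) → Set) → Set
  Scattered q N U = ∀ (v w₁ w₂ : Fin N → Carrier) →
    U w₁ → U w₂ →
    (∃ λ λ₁ → ∀ k → w₁ k ≈ (λ₁ * v k)) →
    (∃ λ λ₂ → ∀ k → w₂ k ≈ (λ₂ * v k)) →
    ∃ λ a → ∃ λ b → InFq q a × InFq q b × ¬ (a ≈ 0# × b ≈ 0#) ×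
      (∀ k → ((a * w₁ k) + (b * w₂ k)) ≈ 0#)

  -- the vector (x_1,…,x_m, f_1(x),…,f_m(x)) ∈ F^{2m}, indices 0-based mod m:
  -- f_i(x) = x_i^{q^I} + α_{i+1} x_{i+1}^{q^J}, with i+1 taken mod m
  -- (so f_m(x) = x_m^{q^I} + α_1 x_1^{q^J}).
  Uvec : (q I J m : ℕ) .{{_ : NonZero m}} → (Fin m → Carrier) → (Fin m → Carrier) →
         Fin (m N.+ m) → Carrier
  Uvec q I J m α x k = [ x , f ]′ (splitAt m k)
    where
    f : Fin m → Carrier
    f i = (x i ^F (q N.^ I)) + (α (suc (toℕ i) mod m) * (x (suc (toℕ i) mod m) ^F (q N.^ J)))

  USet : (q I J m : ℕ) .{{_ : NonZero m}} → (Fin m → Carrier) → (Fin (m N.+ m) → Carrier) → Set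
  USet q I J m α w = ∃ λ x → ∀ k → w k ≈ Uvec q I J m α x k

  -- K^{I,J}_A = α_3 α_4^{q^K} ⋯ α_m^{q^{(m-3)K}} α_1^{q^{(m-2)K}} / α_2^{C_{K,m-1}}
  -- (1-based); with 0-based indices mod m the numerator is
  -- ∏_{j=0}^{m-2} α_{(j+2) mod m}^{q^{jK}}.
  Kelt : (q K m : ℕ) .{{_ : NonZero m}} → (Fin m → Carrier) → Carrier
  Kelt q K m α = prod (N._∸_ m 1) (λ j → α ((j N.+ 2) mod m) ^F (q N.^ (j N.* K)))
                 * ((α (1 mod m) ^F C q K (N._∸_ m 1)) ⁻¹)

{-# OPTIONS --safe #-}
-- Let w₁ = (x, f(x)) and w₂ = l w₁ both lie in U.  Comparing coordinates gives f(l x) = l f(x),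
-- that is μ x_i^(q^I) + ν α_{i+1} x_{i+1}^(q^J) = 0 with μ = l^(q^I) − l and ν = l^(q^J) − l.
-- If μ = ν = 0 then l is fixed by x ↦ x^(q^I) and x ↦ x^(q^J), hence by x ↦ x^q as gcd(I, J) = 1,
-- so l ∈ F_q and w₁, w₂ are F_q-dependent.  If exactly one of μ, ν vanishes then x = 0.
-- Otherwise z_j = x_j^(q^I) satisfies z_j = c α_{j+1} z_{j+1}^(q^K); going once round the cycle
-- makes α₂ α₃^(q^K) ⋯ α₁^(q^((m-1)K)) a C_{K,m}-th power in F_(q^(nℓ)).  For ℓ ≡ 1 (mod C_{K,m})
-- taking norms shows it is a C_{K,m}-th power in F_(q^n) already, and since it equals
-- (K^{I,J}_A)^(q^K) α₂^(C_{K,m}), so is K^{I,J}_A, contrary to the hypothesis.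
module Submission where

open import Defs
import Data.Nat as ℕ
import Data.Nat.Properties as ℕ
open import Data.Nat using (ℕ; zero; suc; NonZero; _≤_; _<_; s≤s; z≤n)
open import Data.Nat.DivMod using (_mod_; %-distribˡ-+; m%n%n≡m%n; m<n⇒m%n≡m; [m+n]%n≡m%n)
open import Data.Nat.Divisibility using (_∣_; divides; m∣m*n)
open import Data.Nat.GCD using (gcd; gcd-GCD; module Bézout)
open import Data.Nat.Primality using (prime⇒nonZero)
open import Data.Nat.Tactic.RingSolver using (solve-∀)
open import Data.Fin as Fin using (Fin; toℕ; punchIn; punchOut; _↑ˡ_; _↑ʳ_; splitAt)
import Data.Fin.Properties as Fin
open import Data.Fin.Permutation using (Permutation′; permutation)
open import Data.List using (List; []; _∷_; length; replicate; _++_)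
open import Data.List.Relation.Unary.All using (All; []; _∷_)
open import Data.Product using (Σ; ∃; _×_; _,_; proj₁; proj₂)
open import Data.Sum using (_⊎_; inj₁; inj₂)
open import Data.Empty using (⊥-elim)
open import Function using (_∘_)
open import Relation.Nullary using (¬_; yes; no; ¬?)
open import Relation.Nullary.Decidable using (decidable-stable)
open import Relation.Binary.Definitions using (Decidable)
open import Relation.Binary.PropositionalEquality as ≡ using (_≡_; _≢_; cong; cong₂)
import Algebra.Bundles
open import Algebra.Morphism.Structures using (module RingMorphisms)

module Arithmetic where
  open import Data.Nat using (_+_; _*_; _^_; _%_)
  open ≡.≡-Reasoning

  ^-*-suc : ∀ q h k → q ^ (h * suc k) ≡ q ^ h * q ^ (h * k)
  ^-*-suc q h k = ≡.trans (cong (q ^_) (ℕ.*-suc h k)) (ℕ.^-distribˡ-+-* q h (h * k))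

  C-geometric : ∀ q h k → C q h k * q ^ h + 1 ≡ C q h k + q ^ (h * k)
  C-geometric q h zero    = cong (q ^_) (≡.sym (ℕ.*-zeroʳ h))
  C-geometric q h (suc k) = begin
    (Q + C q h k) * q ^ h + 1          ≡⟨ rearrange Q (C q h k) (q ^ h) ⟩
    Q * q ^ h + (C q h k * q ^ h + 1)  ≡⟨ cong (Q * q ^ h +_) (C-geometric q h k) ⟩
    Q * q ^ h + (C q h k + Q)          ≡⟨ cong (_+ (C q h k + Q)) Q*qʰ≡ ⟩
    q ^ (h * suc k) + (C q h k + Q)    ≡⟨ rotate (q ^ (h * suc k)) (C q h k) Q ⟩
    (Q + C q h k) + q ^ (h * suc k)    ∎
    where
    Q = q ^ (h * k)
    Q*qʰ≡ : Q * q ^ h ≡ q ^ (h * suc k)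
    Q*qʰ≡ = ≡.trans (ℕ.*-comm Q (q ^ h)) (≡.sym (^-*-suc q h k))
    rearrange : ∀ a b c → (a + b) * c + 1 ≡ a * c + (b * c + 1)
    rearrange = solve-∀
    rotate : ∀ a b c → a + (b + c) ≡ (c + b) + a
    rotate = solve-∀

  C-suc : ∀ q h k → C q h (suc k) ≡ C q h k * q ^ h + 1
  C-suc q h k = ≡.trans (ℕ.+-comm (q ^ (h * k)) (C q h k)) (≡.sym (C-geometric q h k))

  C-telescope : ∀ q h k {d} → q ^ h ≡ suc d → d * C q h k + 1 ≡ q ^ (h * k)
  C-telescope q h k {d} qʰ≡1+d = ℕ.+-cancelˡ-≡ (C q h k) _ _ (begin
    C q h k + (d * C q h k + 1)  ≡⟨ rearrange (C q h k) d ⟩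
    C q h k * suc d + 1          ≡⟨ cong (λ e → C q h k * e + 1) qʰ≡1+d ⟨
    C q h k * q ^ h + 1          ≡⟨ C-geometric q h k ⟩
    C q h k + q ^ (h * k)        ∎)
    where
    rearrange : ∀ c d → c + (d * c + 1) ≡ c * suc d + 1
    rearrange = solve-∀

  C-positive : ∀ q h k .{{_ : NonZero q}} .{{_ : NonZero k}} → 0 < C q h k
  C-positive q h (suc k) = ℕ.<-≤-trans (ℕ.m^n>0 q (h * k)) (ℕ.m≤m+n _ _)

  even⊎odd : ∀ n → ∃ (λ k → n ≡ k + k) ⊎ ∃ (λ k → n ≡ suc (k + k))
  even⊎odd zero    = inj₁ (0 , ≡.refl)
  even⊎odd (suc n) with even⊎odd n
  ... | inj₁ (k , n≡2k)   = inj₂ (k , cong suc n≡2k)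
  ... | inj₂ (k , n≡2k+1) = inj₁ (suc k , cong suc (≡.trans n≡2k+1 (≡.sym (ℕ.+-suc k k))))

  ∣-^ : ∀ q e .{{_ : NonZero e}} → q ∣ q ^ e
  ∣-^ q (suc e) = m∣m*n (q ^ e)

  IsPrimePower⇒NonZero : ∀ {q} → IsPrimePower q → NonZero q
  IsPrimePower⇒NonZero (p , e , p-prime , _ , q≡pᵉ) =
    ≡.subst NonZero (≡.sym q≡pᵉ) (ℕ.m^n≢0 p e {{prime⇒nonZero p-prime}})

  distinct⇒2≤n : ∀ {n} (i j : Fin n) → i ≢ j → 2 ≤ n
  distinct⇒2≤n {suc zero}    Fin.zero Fin.zero i≢j with () ← i≢j ≡.refl
  distinct⇒2≤n {suc (suc n)} _        _        _   = s≤s (s≤s z≤n)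

  module _ (m : ℕ) .{{_ : NonZero m}} where

    toℕ-mod : ∀ a → toℕ (a mod m) ≡ a % m
    toℕ-mod a = Fin.toℕ-fromℕ< _

    mod-cong : ∀ {a b} → a % m ≡ b % m → a mod m ≡ b mod m
    mod-cong {a} {b} eq = Fin.toℕ-injective (≡.trans (toℕ-mod a) (≡.trans eq (≡.sym (toℕ-mod b))))

    toℕ-mod-id : ∀ (k : Fin m) → toℕ k mod m ≡ k
    toℕ-mod-id k = Fin.toℕ-injective (≡.trans (toℕ-mod (toℕ k)) (m<n⇒m%n≡m (Fin.toℕ<n k)))

    +-mod-periodic : ∀ a → (a + m) mod m ≡ a mod m
    +-mod-periodic a = mod-cong ([m+n]%n≡m%n a m)

    suc-toℕ-mod : ∀ a → suc (toℕ (a mod m)) mod m ≡ suc a mod m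
    suc-toℕ-mod a = mod-cong (begin
      suc (toℕ (a mod m)) % m   ≡⟨ cong (λ r → suc r % m) (toℕ-mod a) ⟩
      (1 + a % m) % m           ≡⟨ %-distribˡ-+ 1 (a % m) m ⟩
      (1 % m + a % m % m) % m   ≡⟨ cong (λ r → (1 % m + r) % m) (m%n%n≡m%n a m) ⟩
      (1 % m + a % m) % m       ≡⟨ %-distribˡ-+ 1 a m ⟨
      (1 + a) % m               ∎)

    mod-suc-surjective : ∀ (k : Fin m) → suc (toℕ k + ℕ.pred m) mod m ≡ k
    mod-suc-surjective k = begin
      suc (toℕ k + ℕ.pred m) mod m    ≡⟨ cong (_mod m) (ℕ.+-suc (toℕ k) (ℕ.pred m)) ⟨
      (toℕ k + suc (ℕ.pred m)) mod m  ≡⟨ cong (λ n → (toℕ k + n) mod m) (ℕ.suc-pred m) ⟩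
      (toℕ k + m) mod m               ≡⟨ +-mod-periodic (toℕ k) ⟩
      toℕ k mod m                     ≡⟨ toℕ-mod-id k ⟩
      k                               ∎

open Arithmetic

module FieldProperties (F : FiniteField) where
  open FiniteField F
  open import Relation.Binary.Reasoning.Setoid setoid
  open import Algebra.Properties.CommutativeSemiring.Exp commutativeSemiring public
    hiding (_^_)
  open import Algebra.Properties.Ring (Algebra.Bundles.CommutativeRing.ring ring) public
    using (-1*x≈-x; -‿distribˡ-*; -‿distribʳ-*; -‿involutive; -‿injective; -0#≈0#; -‿+-comm;
           [y-z]x≈yx-zx; +-inverseˡ-unique)
    renaming (x∙y⁻¹≈ε⇒x≈y to x-y≈0⇒x≈y; x≈y⇒x∙y⁻¹≈ε to x≈y⇒x-y≈0)
  open import Algebra.Properties.CommutativeSemigroup +-commutativeSemigroup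
    using () renaming (interchange to +-interchange)
  open import Algebra.Properties.CommutativeSemigroup *-commutativeSemigroup public
    using () renaming (x∙yz≈y∙xz to x*yz≈y*xz)
  open import Algebra.Properties.CommutativeMonoid.Sum *-commutativeMonoid
    using (sum-permute; sum-cong-≋; sum-replicate; ∑-distrib-+)
    renaming (sum to ∏)

  index : Carrier → Fin size
  index x = proj₁ (enum-sur x)

  enum-index : ∀ x → enum (index x) ≈ x
  enum-index x = proj₂ (enum-sur x)

  infix 4 _≟_
  _≟_ : Decidable _≈_
  x ≟ y with index x Fin.≟ index y
  ... | yes i≡j = yes (trans (sym (enum-index x)) (trans (reflexive (cong enum i≡j)) (enum-index y)))
  ... | no i≢j  = no λ x≈y → i≢j (enum-inj _ _ (trans (enum-index x) (trans x≈y (sym (enum-index y)))))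

  inverseˡ : ∀ x → x ≉ 0# → x ⁻¹ * x ≈ 1#
  inverseˡ x x≉0 = trans (*-comm _ _) (inverseʳ x x≉0)

  *-cancelˡ : ∀ {x y z} → x ≉ 0# → x * y ≈ x * z → y ≈ z
  *-cancelˡ {x} {y} {z} x≉0 xy≈xz = begin
    y                ≈⟨ *-identityˡ y ⟨
    1# * y           ≈⟨ *-congʳ (inverseˡ x x≉0) ⟨
    (x ⁻¹ * x) * y   ≈⟨ *-assoc _ _ _ ⟩
    x ⁻¹ * (x * y)   ≈⟨ *-congˡ xy≈xz ⟩
    x ⁻¹ * (x * z)   ≈⟨ *-assoc _ _ _ ⟨
    (x ⁻¹ * x) * z   ≈⟨ *-congʳ (inverseˡ x x≉0) ⟩
    1# * z           ≈⟨ *-identityˡ z ⟩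
    z                ∎

  *-cancelʳ : ∀ {x y z} → x ≉ 0# → y * x ≈ z * x → y ≈ z
  *-cancelʳ x≉0 yx≈zx = *-cancelˡ x≉0 (trans (*-comm _ _) (trans yx≈zx (*-comm _ _)))

  x≉0∧xy≈0⇒y≈0 : ∀ {x y} → x ≉ 0# → x * y ≈ 0# → y ≈ 0#
  x≉0∧xy≈0⇒y≈0 x≉0 xy≈0 = *-cancelˡ x≉0 (trans xy≈0 (sym (zeroʳ _)))

  x≈0⇒xy≈0 : ∀ {x} y → x ≈ 0# → x * y ≈ 0#
  x≈0⇒xy≈0 y x≈0 = trans (*-congʳ x≈0) (zeroˡ y)

  *-≉0 : ∀ {x y} → x ≉ 0# → y ≉ 0# → x * y ≉ 0#
  *-≉0 x≉0 y≉0 xy≈0 = y≉0 (x≉0∧xy≈0⇒y≈0 x≉0 xy≈0)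

  ⁻¹-≉0 : ∀ {x} → x ≉ 0# → x ⁻¹ ≉ 0#
  ⁻¹-≉0 {x} x≉0 x⁻¹≈0 = 1≉0 (trans (sym (inverseʳ x x≉0)) (trans (*-congˡ x⁻¹≈0) (zeroʳ x)))

  -‿≉0 : ∀ {x} → x ≉ 0# → - x ≉ 0#
  -‿≉0 x≉0 -x≈0 = x≉0 (-‿injective (trans -x≈0 (sym -0#≈0#)))

  ^-≉0 : ∀ {x} n → x ≉ 0# → x ^F n ≉ 0#
  ^-≉0 zero    x≉0 = 1≉0
  ^-≉0 (suc n) x≉0 = *-≉0 x≉0 (^-≉0 n x≉0)

  x^n≈0⇒x≈0 : ∀ {x} n → x ^F n ≈ 0# → x ≈ 0#
  x^n≈0⇒x≈0 {x} n xⁿ≈0 with x ≟ 0#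
  ... | yes x≈0 = x≈0
  ... | no x≉0  = ⊥-elim (^-≉0 n x≉0 xⁿ≈0)

  0^n≈0 : ∀ n .{{_ : NonZero n}} → 0# ^F n ≈ 0#
  0^n≈0 (suc n) = zeroˡ _

  1^n≈1 : ∀ n → 1# ^F n ≈ 1#
  1^n≈1 zero    = refl
  1^n≈1 (suc n) = trans (*-identityˡ _) (1^n≈1 n)

  x≈0∧x+y≈0⇒y≈0 : ∀ {x y} → x ≈ 0# → x + y ≈ 0# → y ≈ 0#
  x≈0∧x+y≈0⇒y≈0 x≈0 x+y≈0 = trans (sym (+-identityˡ _)) (trans (+-congʳ (sym x≈0)) x+y≈0)

  y≈0∧x+y≈0⇒x≈0 : ∀ {x y} → y ≈ 0# → x + y ≈ 0# → x ≈ 0#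
  y≈0∧x+y≈0⇒x≈0 y≈0 x+y≈0 = x≈0∧x+y≈0⇒y≈0 y≈0 (trans (+-comm _ _) x+y≈0)

  ax+bz≈cx+cz⇒[a-c]x+[b-c]z≈0 : ∀ a b c x z → a * x + b * z ≈ c * x + c * z →
                                  (a - c) * x + (b - c) * z ≈ 0#
  ax+bz≈cx+cz⇒[a-c]x+[b-c]z≈0 a b c x z eq = begin
    (a - c) * x + (b - c) * z                  ≈⟨ +-cong ([y-z]x≈yx-zx x a c) ([y-z]x≈yx-zx z b c) ⟩
    (a * x - c * x) + (b * z - c * z)          ≈⟨ +-interchange (a * x) _ (b * z) _ ⟩
    (a * x + b * z) + (- (c * x) + - (c * z))  ≈⟨ +-congˡ (-‿+-comm (c * x) (c * z)) ⟩
    (a * x + b * z) - (c * x + c * z)          ≈⟨ x≈y⇒x-y≈0 eq ⟩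
    0#                                         ∎

  ax+by≈0⇒x≈-[a⁻¹b]y : ∀ {a b x y} → a ≉ 0# → a * x + b * y ≈ 0# → x ≈ - (a ⁻¹ * b) * y
  ax+by≈0⇒x≈-[a⁻¹b]y {a} {b} {x} {y} a≉0 ax+by≈0 = begin
    x                   ≈⟨ *-identityˡ x ⟨
    1# * x              ≈⟨ *-congʳ (inverseˡ a a≉0) ⟨
    (a ⁻¹ * a) * x      ≈⟨ *-assoc _ _ _ ⟩
    a ⁻¹ * (a * x)      ≈⟨ *-congˡ (+-inverseˡ-unique _ _ ax+by≈0) ⟩
    a ⁻¹ * - (b * y)    ≈⟨ -‿distribʳ-* _ _ ⟨
    - (a ⁻¹ * (b * y))  ≈⟨ -‿cong (*-assoc _ _ _) ⟨
    - ((a ⁻¹ * b) * y)  ≈⟨ -‿distribˡ-* _ _ ⟩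
    - (a ⁻¹ * b) * y    ∎

  proportional : ∀ {N} {v w₁ w₂ : Fin N → Carrier} {λ₁ λ₂} → λ₁ ≉ 0# →
                 (∀ k → w₁ k ≈ λ₁ * v k) → (∀ k → w₂ k ≈ λ₂ * v k) →
                 ∀ k → w₂ k ≈ (λ₂ * λ₁ ⁻¹) * w₁ k
  proportional {v = v} {w₁} {w₂} {λ₁} {λ₂} λ₁≉0 w₁≈λ₁v w₂≈λ₂v k = begin
    w₂ k                       ≈⟨ w₂≈λ₂v k ⟩
    λ₂ * v k                   ≈⟨ *-congˡ (*-identityˡ (v k)) ⟨
    λ₂ * (1# * v k)            ≈⟨ *-congˡ (*-congʳ (inverseˡ λ₁ λ₁≉0)) ⟨
    λ₂ * ((λ₁ ⁻¹ * λ₁) * v k)  ≈⟨ *-congˡ (*-assoc _ _ _) ⟩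
    λ₂ * (λ₁ ⁻¹ * (λ₁ * v k))  ≈⟨ *-assoc _ _ _ ⟨
    (λ₂ * λ₁ ⁻¹) * (λ₁ * v k)  ≈⟨ *-congˡ (w₁≈λ₁v k) ⟨
    (λ₂ * λ₁ ⁻¹) * w₁ k        ∎

  prod-cong : ∀ k {f g : ℕ → Carrier} → (∀ j → f j ≈ g j) → prod F k f ≈ prod F k g
  prod-cong zero    f≈g = refl
  prod-cong (suc k) f≈g = *-cong (prod-cong k f≈g) (f≈g k)

  prod-unconsˡ : ∀ k g → prod F (suc k) g ≈ g 0 * prod F k (g ∘ suc)
  prod-unconsˡ zero    g = trans (*-identityˡ _) (sym (*-identityʳ _))
  prod-unconsˡ (suc k) g = begin
    prod F (suc k) g * g (suc k)            ≈⟨ *-congʳ (prod-unconsˡ k g) ⟩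
    (g 0 * prod F k (g ∘ suc)) * g (suc k)  ≈⟨ *-assoc _ _ _ ⟩
    g 0 * prod F (suc k) (g ∘ suc)          ∎

  prod-^ : ∀ k f e → prod F k (λ j → f j ^F e) ≈ prod F k f ^F e
  prod-^ zero    f e = sym (1^n≈1 e)
  prod-^ (suc k) f e = trans (*-congʳ (prod-^ k f e)) (sym (^-distrib-* (prod F k f) (f k) e))

  module _ {n} (e : Fin n → Carrier) (e-injective : ∀ i j → e i ≈ e j → i ≡ j)
           (e-≉0 : ∀ i → e i ≉ 0#) (e-onto : ∀ x → x ≉ 0# → ∃ λ i → e i ≈ x) where

    -- Multiplication by a unit permutes the enumerated units, so it scales their product by aⁿ.
    ^-#units≈1 : ∀ a → a ≉ 0# → a ^F n ≈ 1#
    ^-#units≈1 a a≉0 = *-cancelʳ (∏-≉0 n e e-≉0) (begin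
      a ^F n * ∏ e                ≈⟨ *-congʳ (sum-replicate n) ⟨
      ∏ {n} (λ _ → a) * ∏ e       ≈⟨ ∑-distrib-+ (λ _ → a) e ⟨
      ∏ {n} (λ i → a * e i)       ≈⟨ sum-cong-≋ (λ i → sym (proj₂ (times a a≉0 i))) ⟩
      ∏ (λ i → e (σ i))           ≈⟨ sum-permute e π ⟨
      ∏ e                         ≈⟨ *-identityˡ _ ⟨
      1# * ∏ e                    ∎)
      where
      ∏-≉0 : ∀ k (f : Fin k → Carrier) → (∀ i → f i ≉ 0#) → ∏ f ≉ 0#
      ∏-≉0 zero    f f≉0 = 1≉0
      ∏-≉0 (suc k) f f≉0 = *-≉0 (f≉0 Fin.zero) (∏-≉0 k (f ∘ Fin.suc) (f≉0 ∘ Fin.suc))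
      times : ∀ b → b ≉ 0# → ∀ i → ∃ λ j → e j ≈ b * e i
      times b b≉0 i = e-onto (b * e i) (*-≉0 b≉0 (e-≉0 i))
      σ τ : Fin n → Fin n
      σ i = proj₁ (times a a≉0 i)
      τ i = proj₁ (times (a ⁻¹) (⁻¹-≉0 a≉0) i)
      cancel : ∀ b c i → b * c ≈ 1# → e i ≈ b * (c * e i)
      cancel b c i bc≈1 = sym (trans (sym (*-assoc _ _ _)) (trans (*-congʳ bc≈1) (*-identityˡ _)))
      στ : ∀ i → σ (τ i) ≡ i
      στ i = e-injective _ _ (trans (proj₂ (times a a≉0 (τ i)))
        (trans (*-congˡ (proj₂ (times (a ⁻¹) (⁻¹-≉0 a≉0) i))) (sym (cancel a (a ⁻¹) i (inverseʳ a a≉0)))))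
      τσ : ∀ i → τ (σ i) ≡ i
      τσ i = e-injective _ _ (trans (proj₂ (times (a ⁻¹) (⁻¹-≉0 a≉0) (σ i)))
        (trans (*-congˡ (proj₂ (times a a≉0 i))) (sym (cancel (a ⁻¹) a i (inverseˡ a a≉0)))))
      π : Permutation′ n
      π = permutation σ τ στ τσ

  fermat : ∀ x → x ^F size ≈ x
  fermat = fermat-enum enum enum-inj enum-sur
    where
    fermat-enum : ∀ {n} (e : Fin n → Carrier) → (∀ i j → e i ≈ e j → i ≡ j) →
                  (∀ x → ∃ λ i → e i ≈ x) → ∀ x → x ^F n ≈ x
    fermat-enum {zero}  e e-inj e-sur x with () ← proj₁ (e-sur 0#)
    fermat-enum {suc n} e e-inj e-sur x with x ≟ 0#
    ... | yes x≈0 = trans (^-congˡ (suc n) x≈0) (trans (0^n≈0 (suc n)) (sym x≈0))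
    ... | no x≉0  = trans (*-congˡ (^-#units≈1 e′ e′-inj e′-≉0 e′-onto x x≉0)) (*-identityʳ x)
      where
      z = proj₁ (e-sur 0#)
      e′ : Fin n → Carrier
      e′ = e ∘ punchIn z
      e′-inj : ∀ i j → e′ i ≈ e′ j → i ≡ j
      e′-inj i j e′ᵢ≈e′ⱼ = Fin.punchIn-injective z i j (e-inj _ _ e′ᵢ≈e′ⱼ)
      e′-≉0 : ∀ i → e′ i ≉ 0#
      e′-≉0 i e′ᵢ≈0 = Fin.punchInᵢ≢i z i (e-inj _ _ (trans e′ᵢ≈0 (sym (proj₂ (e-sur 0#)))))
      e′-onto : ∀ y → y ≉ 0# → ∃ λ i → e′ i ≈ y
      e′-onto y y≉0 = punchOut z≢j , trans (reflexive (cong e (Fin.punchIn-punchOut z≢j))) (proj₂ (e-sur y))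
        where
        z≢j : z ≢ proj₁ (e-sur y)
        z≢j z≡j = y≉0 (trans (sym (proj₂ (e-sur y))) (trans (reflexive (cong e (≡.sym z≡j))) (proj₂ (e-sur 0#))))

  2≤size : 2 ℕ.≤ size
  2≤size = distinct⇒2≤n (index 0#) (index 1#) λ i₀≡i₁ →
    1≉0 (trans (sym (enum-index 1#)) (trans (reflexive (cong enum (≡.sym i₀≡i₁))) (enum-index 0#)))

  -1^[n+n]≈1 : ∀ n → (- 1#) ^F (n ℕ.+ n) ≈ 1#
  -1^[n+n]≈1 n = begin
    (- 1#) ^F (n ℕ.+ n)        ≈⟨ ^-homo-* (- 1#) n n ⟩
    (- 1#) ^F n * (- 1#) ^F n  ≈⟨ ^-distrib-* (- 1#) (- 1#) n ⟨
    (- 1# * - 1#) ^F n         ≈⟨ ^-congˡ n (trans (-1*x≈-x (- 1#)) (-‿involutive 1#)) ⟩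
    1# ^F n                    ≈⟨ 1^n≈1 n ⟩
    1#                         ∎

  -- In even characteristic -1 ≈ 1, as (-1)^size is both -1 (Fermat) and 1 (size is even).
  -1^q≈-1 : ∀ q → q ∣ size → (- 1#) ^F q ≈ - 1#
  -1^q≈-1 q (divides r size≡rq) with even⊎odd q
  ... | inj₂ (k , q≡1+2k) = trans (^-congʳ (- 1#) q≡1+2k) (trans (*-congˡ (-1^[n+n]≈1 k)) (*-identityʳ _))
  ... | inj₁ (k , q≡2k)   = trans (^-congʳ (- 1#) q≡2k) (trans (-1^[n+n]≈1 k) 1≈-1)
    where
    size≡2rk : size ≡ r ℕ.* k ℕ.+ r ℕ.* k
    size≡2rk = ≡.trans size≡rq (≡.trans (cong (r ℕ.*_) q≡2k) (ℕ.*-distribˡ-+ r k k))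
    1≈-1 : 1# ≈ - 1#
    1≈-1 = trans (sym (-1^[n+n]≈1 (r ℕ.* k))) (trans (^-congʳ (- 1#) (≡.sym size≡2rk)) (fermat (- 1#)))

  ^-fixed-^ : ∀ {y} b → y ^F b ≈ y → ∀ e → y ^F (b ℕ.^ e) ≈ y
  ^-fixed-^ {y} b yᵇ≈y zero    = *-identityʳ y
  ^-fixed-^ {y} b yᵇ≈y (suc e) = begin
    y ^F (b ℕ.* b ℕ.^ e)   ≈⟨ ^-assocʳ y b (b ℕ.^ e) ⟨
    (y ^F b) ^F (b ℕ.^ e)  ≈⟨ ^-congˡ (b ℕ.^ e) yᵇ≈y ⟩
    y ^F (b ℕ.^ e)         ≈⟨ ^-fixed-^ b yᵇ≈y e ⟩
    y                      ∎

  ^-fixed-* : ∀ q a {y} → y ^F (q ℕ.^ a) ≈ y → ∀ k → y ^F (q ℕ.^ (a ℕ.* k)) ≈ y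
  ^-fixed-* q a {y} fixᵃ k = trans (^-congʳ y (≡.sym (ℕ.^-*-assoc q a k))) (^-fixed-^ (q ℕ.^ a) fixᵃ k)

  ^-fixed-Bézout : ∀ q a b u v {y} → 1 ℕ.+ u ℕ.* a ≡ v ℕ.* b →
                   y ^F (q ℕ.^ a) ≈ y → y ^F (q ℕ.^ b) ≈ y → y ^F q ≈ y
  ^-fixed-Bézout q a b u v {y} 1+ua≡vb fixᵃ fixᵇ = begin
    y ^F q                          ≈⟨ ^-congˡ q (^-fixed-* q a fixᵃ u) ⟨
    (y ^F (q ℕ.^ (a ℕ.* u))) ^F q   ≈⟨ ^-assocʳ y (q ℕ.^ (a ℕ.* u)) q ⟩
    y ^F (q ℕ.^ (a ℕ.* u) ℕ.* q)    ≈⟨ ^-congʳ y exponents ⟩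
    y ^F (q ℕ.^ (b ℕ.* v))          ≈⟨ ^-fixed-* q b fixᵇ v ⟩
    y                               ∎
    where
    exponents : q ℕ.^ (a ℕ.* u) ℕ.* q ≡ q ℕ.^ (b ℕ.* v)
    exponents = ≡.trans (ℕ.*-comm _ q)
      (cong (q ℕ.^_) (≡.trans (cong suc (ℕ.*-comm a u)) (≡.trans 1+ua≡vb (ℕ.*-comm v b))))

  ^-fixed-gcd : ∀ q a b {y} → gcd a b ≡ 1 →
                y ^F (q ℕ.^ a) ≈ y → y ^F (q ℕ.^ b) ≈ y → y ^F q ≈ y
  ^-fixed-gcd q a b gcd≡1 fixᵃ fixᵇ
    with ≡.subst (λ d → Bézout.Identity d a b) gcd≡1 (Bézout.identity (gcd-GCD a b))
  ... | Bézout.+- u v 1+vb≡ua = ^-fixed-Bézout q b a v u 1+vb≡ua fixᵇ fixᵃ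
  ... | Bézout.-+ u v 1+ua≡vb = ^-fixed-Bézout q a b u v 1+ua≡vb fixᵃ fixᵇ

  ^-C-size : ∀ x k → x ^F C size 1 k ≈ x ^F k
  ^-C-size x zero    = refl
  ^-C-size x (suc k) = trans (^-homo-* x (size ℕ.^ (1 ℕ.* k)) (C size 1 k))
                             (*-cong (^-fixed-^ size (fermat x) (1 ℕ.* k)) (^-C-size x k))

  -- w ^F C s 1 ℓ is the norm of w down to the subfield with s elements.
  ^-C-fixed : ∀ s ℓ {w} → w ≉ 0# → size ≡ s ℕ.^ ℓ → (w ^F C s 1 ℓ) ^F s ≈ w ^F C s 1 ℓ
  ^-C-fixed s ℓ {w} w≉0 size≡sˡ = *-cancelʳ w≉0 (begin
    (w ^F T) ^F s * w        ≈⟨ *-cong (^-assocʳ w T s) (sym (*-identityʳ w)) ⟩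
    w ^F (T ℕ.* s) * w ^F 1  ≈⟨ ^-homo-* w (T ℕ.* s) 1 ⟨
    w ^F (T ℕ.* s ℕ.+ 1)     ≈⟨ ^-congʳ w exponents ⟩
    w ^F (T ℕ.+ size)        ≈⟨ ^-homo-* w T size ⟩
    w ^F T * w ^F size       ≈⟨ *-congˡ (fermat w) ⟩
    w ^F T * w               ∎)
    where
    T = C s 1 ℓ
    exponents : T ℕ.* s ℕ.+ 1 ≡ T ℕ.+ size
    exponents = ≡.trans (cong (λ e → T ℕ.* e ℕ.+ 1) (≡.sym (ℕ.*-identityʳ s)))
      (≡.trans (C-geometric s 1 ℓ)
      (≡.trans (cong (λ e → T ℕ.+ s ℕ.^ e) (ℕ.*-identityˡ ℓ)) (cong (T ℕ.+_) (≡.sym size≡sˡ))))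

  IsUnitPower : ℕ → Carrier → Set
  IsUnitPower c a = ∃ λ w → w ≉ 0# × w ^F c ≈ a

  IsPower-resp : ∀ c {x y} → x ≈ y → IsPower F c x → IsPower F c y
  IsPower-resp c x≈y (t , tᶜ≈x) = t , trans tᶜ≈x x≈y

  x*yᶜ*[y⁻¹]ᶜ≈x : ∀ c {x y} → y ≉ 0# → (x * y ^F c) * (y ⁻¹) ^F c ≈ x
  x*yᶜ*[y⁻¹]ᶜ≈x c {x} {y} y≉0 = begin
    (x * y ^F c) * (y ⁻¹) ^F c  ≈⟨ *-assoc _ _ _ ⟩
    x * (y ^F c * (y ⁻¹) ^F c)  ≈⟨ *-congˡ (^-distrib-* y (y ⁻¹) c) ⟨
    x * (y * y ⁻¹) ^F c         ≈⟨ *-congˡ (^-congˡ c (inverseʳ y y≉0)) ⟩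
    x * 1# ^F c                 ≈⟨ *-congˡ (1^n≈1 c) ⟩
    x * 1#                      ≈⟨ *-identityʳ x ⟩
    x                           ∎

  IsPower-*-^⇒IsPower : ∀ c {x y} → y ≉ 0# → IsPower F c (x * y ^F c) → IsPower F c x
  IsPower-*-^⇒IsPower c {x} {y} y≉0 (t , tᶜ≈xyᶜ) = t * y ⁻¹ ,
    trans (^-distrib-* t (y ⁻¹) c) (trans (*-congʳ tᶜ≈xyᶜ) (x*yᶜ*[y⁻¹]ᶜ≈x c y≉0))

  x*yᶜ≈1⇒IsUnitPower : ∀ c {x y} → y ≉ 0# → x * y ^F c ≈ 1# → IsUnitPower c x
  x*yᶜ≈1⇒IsUnitPower c {x} {y} y≉0 xyᶜ≈1 = y ⁻¹ , ⁻¹-≉0 y≉0 ,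
    trans (sym (*-identityˡ _)) (trans (*-congʳ (sym xyᶜ≈1)) (x*yᶜ*[y⁻¹]ᶜ≈x c y≉0))

  IsPower-^q^K⇒IsPower : ∀ q n K c .{{_ : NonZero n}} {x} → size ≡ q ℕ.^ n →
                          IsPower F c (x ^F q ℕ.^ K) → IsPower F c x
  IsPower-^q^K⇒IsPower q (suc n) K c {x} size≡qⁿ⁺¹ (t , tᶜ≈x^qᴷ) = t ^F e , (begin
    (t ^F e) ^F c         ≈⟨ ^-assocʳ t e c ⟩
    t ^F (e ℕ.* c)        ≈⟨ ^-congʳ t (ℕ.*-comm e c) ⟩
    t ^F (c ℕ.* e)        ≈⟨ ^-assocʳ t c e ⟨
    (t ^F c) ^F e         ≈⟨ ^-congˡ e tᶜ≈x^qᴷ ⟩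
    (x ^F q ℕ.^ K) ^F e   ≈⟨ ^-assocʳ x (q ℕ.^ K) e ⟩
    x ^F (q ℕ.^ K ℕ.* e)  ≈⟨ ^-congʳ x exponents ⟩
    x ^F (size ℕ.^ K)     ≈⟨ ^-fixed-^ size (fermat x) K ⟩
    x                     ∎)
    where
    e = q ℕ.^ (K ℕ.* n)
    exponents : q ℕ.^ K ℕ.* e ≡ size ℕ.^ K
    exponents = ≡.trans (≡.sym (^-*-suc q K n)) (≡.trans (cong (q ℕ.^_) (ℕ.*-comm K (suc n)))
      (≡.trans (≡.sym (ℕ.^-*-assoc q (suc n) K)) (cong (ℕ._^ K) (≡.sym size≡qⁿ⁺¹))))

  FqDependent : ℕ → ∀ {N} → (w₁ w₂ : Fin N → Carrier) → Set
  FqDependent q w₁ w₂ = ∃ λ a → ∃ λ b → InFq F q a × InFq F q b × ¬ (a ≈ 0# × b ≈ 0#) ×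
                          (∀ k → a * w₁ k + b * w₂ k ≈ 0#)

  FqDependent-zeroˡ : ∀ q .{{_ : NonZero q}} {N} {w₁ w₂ : Fin N → Carrier} →
                      (∀ k → w₁ k ≈ 0#) → FqDependent q w₁ w₂
  FqDependent-zeroˡ q {w₁ = w₁} {w₂} w₁≈0 = 1# , 0# , 1^n≈1 q , 0^n≈0 q , (1≉0 ∘ proj₁) , λ k → begin
    1# * w₁ k + 0# * w₂ k  ≈⟨ +-cong (*-identityˡ _) (zeroˡ (w₂ k)) ⟩
    w₁ k + 0#              ≈⟨ +-identityʳ _ ⟩
    w₁ k                   ≈⟨ w₁≈0 k ⟩
    0#                     ∎

  FqDependent-scalar : ∀ q {N} {w₁ w₂ : Fin N → Carrier} {l} → InFq F q l → InFq F q (- 1#) →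
                       (∀ k → w₂ k ≈ l * w₁ k) → FqDependent q w₁ w₂
  FqDependent-scalar q {w₁ = w₁} {w₂} {l} l∈Fq -1∈Fq w₂≈lw₁ =
    l , - 1# , l∈Fq , -1∈Fq , (-‿≉0 1≉0 ∘ proj₂) , λ k → begin
      l * w₁ k + - 1# * w₂ k  ≈⟨ +-congˡ (-1*x≈-x (w₂ k)) ⟩
      l * w₁ k - w₂ k         ≈⟨ x≈y⇒x-y≈0 (sym (w₂≈lw₁ k)) ⟩
      0#                      ∎

module Polynomials (F : FiniteField) where
  open FiniteField F
  open FieldProperties F
  open import Relation.Binary.Reasoning.Setoid setoid
  open import Algebra.Solver.CommutativeMonoid +-commutativeMonoid using (solve; _⊕_; _⊜_)

  eval : List Carrier → Carrier → Carrier
  eval []      x = 0#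
  eval (a ∷ p) x = a + x * eval p x

  quotient : Carrier → List Carrier → List Carrier
  quotient r []          = []
  quotient r (a ∷ [])    = []
  quotient r (a ∷ b ∷ p) = eval (b ∷ p) r ∷ quotient r (b ∷ p)

  length-quotient : ∀ r p → length (quotient r p) ≡ ℕ.pred (length p)
  length-quotient r []          = ≡.refl
  length-quotient r (a ∷ [])    = ≡.refl
  length-quotient r (a ∷ b ∷ p) = cong suc (length-quotient r (b ∷ p))

  a+x*0≈a : ∀ a x → a + x * 0# ≈ a
  a+x*0≈a a x = trans (+-congˡ (zeroʳ x)) (+-identityʳ a)

  eval-quotient : ∀ r p x → eval p x ≈ (x - r) * eval (quotient r p) x + eval p r
  eval-quotient r []          x = sym (trans (+-identityʳ _) (zeroʳ (x - r)))
  eval-quotient r (a ∷ [])    x = begin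
    a + x * 0#                   ≈⟨ a+x*0≈a a x ⟩
    a                            ≈⟨ a+x*0≈a a r ⟨
    a + r * 0#                   ≈⟨ +-identityˡ _ ⟨
    0# + (a + r * 0#)            ≈⟨ +-congʳ (zeroʳ (x - r)) ⟨
    (x - r) * 0# + (a + r * 0#)  ∎
  eval-quotient r (a ∷ b ∷ p) x = begin
    a + x * eval (b ∷ p) x                           ≈⟨ +-congˡ (*-congˡ (eval-quotient r (b ∷ p) x)) ⟩
    a + x * ((x - r) * Q + e)                        ≈⟨ +-congˡ (distribˡ x _ e) ⟩
    a + (x * ((x - r) * Q) + x * e)                  ≈⟨ +-congˡ (+-cong (x*yz≈y*xz x (x - r) Q) (*-congʳ (sym [x-r]+r≈x))) ⟩
    a + ((x - r) * (x * Q) + ((x - r) + r) * e)      ≈⟨ +-congˡ (+-congˡ (distribʳ e (x - r) r)) ⟩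
    a + ((x - r) * (x * Q) + ((x - r) * e + r * e))  ≈⟨ regroup a ((x - r) * (x * Q)) ((x - r) * e) (r * e) ⟩
    ((x - r) * e + (x - r) * (x * Q)) + (a + r * e)  ≈⟨ +-congʳ (distribˡ (x - r) e (x * Q)) ⟨
    (x - r) * (e + x * Q) + (a + r * e)              ∎
    where
    Q = eval (quotient r (b ∷ p)) x
    e = eval (b ∷ p) r
    [x-r]+r≈x : (x - r) + r ≈ x
    [x-r]+r≈x = trans (+-assoc x (- r) r) (trans (+-congˡ (-‿inverseˡ r)) (+-identityʳ x))
    regroup : ∀ a b c d → a + (b + (c + d)) ≈ (c + b) + (a + d)
    regroup = solve 4 (λ a b c d → a ⊕ (b ⊕ (c ⊕ d)) ⊜ (c ⊕ b) ⊕ (a ⊕ d)) refl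

  AllZero : List Carrier → Set
  AllZero = All (_≈ 0#)

  AllZero-quotient : ∀ r p → eval p r ≈ 0# → AllZero (quotient r p) → AllZero p
  AllZero-quotient r []          p[r]≈0 []           = []
  AllZero-quotient r (a ∷ [])    p[r]≈0 []           = trans (sym (a+x*0≈a a r)) p[r]≈0 ∷ []
  AllZero-quotient r (a ∷ b ∷ p) p[r]≈0 (e≈0 ∷ q≈0) =
    trans (sym (a+x*0≈a a r)) (trans (+-congˡ (*-congˡ (sym e≈0))) p[r]≈0) ∷ AllZero-quotient r (b ∷ p) e≈0 q≈0

  roots-bound : ∀ k (r : Fin k → Carrier) → (∀ i j → r i ≈ r j → i ≡ j) →
                ∀ p → length p ≤ k → (∀ i → eval p (r i) ≈ 0#) → AllZero p
  roots-bound zero    r r-inj [] _    _     = []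
  roots-bound (suc k) r r-inj p  |p|≤ roots =
    AllZero-quotient r₀ p (roots Fin.zero)
      (roots-bound k (r ∘ Fin.suc) (λ i j rᵢ≈rⱼ → Fin.suc-injective (r-inj _ _ rᵢ≈rⱼ)) (quotient r₀ p)
        (≡.subst (_≤ k) (≡.sym (length-quotient r₀ p)) (ℕ.pred-mono-≤ |p|≤)) quotient-roots)
    where
    r₀ = r Fin.zero
    quotient-roots : ∀ i → eval (quotient r₀ p) (r (Fin.suc i)) ≈ 0#
    quotient-roots i = x≉0∧xy≈0⇒y≈0 rᵢ-r₀≉0 (begin
      (rᵢ - r₀) * eval (quotient r₀ p) rᵢ              ≈⟨ +-identityʳ _ ⟨
      (rᵢ - r₀) * eval (quotient r₀ p) rᵢ + 0#         ≈⟨ +-congˡ (roots Fin.zero) ⟨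
      (rᵢ - r₀) * eval (quotient r₀ p) rᵢ + eval p r₀  ≈⟨ eval-quotient r₀ p rᵢ ⟨
      eval p rᵢ                                        ≈⟨ roots (Fin.suc i) ⟩
      0#                                               ∎)
      where
      rᵢ = r (Fin.suc i)
      rᵢ-r₀≉0 : rᵢ - r₀ ≉ 0#
      rᵢ-r₀≉0 d≈0 with () ← r-inj _ _ (x-y≈0⇒x≈y _ _ d≈0)

  monomial : ℕ → List Carrier
  monomial t = replicate t 0# ++ 1# ∷ []

  length-monomial : ∀ t → length (monomial t) ≡ suc t
  length-monomial zero    = ≡.refl
  length-monomial (suc t) = cong suc (length-monomial t)

  eval-monomial : ∀ t x → eval (monomial t) x ≈ x ^F t
  eval-monomial zero    x = a+x*0≈a 1# x
  eval-monomial (suc t) x = trans (+-identityˡ _) (*-congˡ (eval-monomial t x))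

  monomial≉0 : ∀ t → ¬ AllZero (monomial t)
  monomial≉0 zero    (1≈0 ∷ _) = 1≉0 1≈0
  monomial≉0 (suc t) (_ ∷ m≈0) = monomial≉0 t m≈0

  -- Xˢ - X with s = 2 + t.
  Xˢ-X : ℕ → List Carrier
  Xˢ-X t = 0# ∷ - 1# ∷ monomial t

  eval-Xˢ-X : ∀ t x → eval (Xˢ-X t) x ≈ x ^F suc (suc t) - x
  eval-Xˢ-X t x = begin
    0# + x * (- 1# + x * eval (monomial t) x)  ≈⟨ +-identityˡ _ ⟩
    x * (- 1# + x * eval (monomial t) x)       ≈⟨ *-congˡ (+-congˡ (*-congˡ (eval-monomial t x))) ⟩
    x * (- 1# + x ^F suc t)                    ≈⟨ distribˡ x (- 1#) _ ⟩
    x * - 1# + x ^F suc (suc t)                ≈⟨ +-comm _ _ ⟩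
    x ^F suc (suc t) + x * - 1#                ≈⟨ +-congˡ (trans (*-comm x (- 1#)) (-1*x≈-x x)) ⟩
    x ^F suc (suc t) - x                       ∎

  ^-fixed-points-bound : ∀ s → 2 ≤ s → (r : Fin (suc s) → Carrier) →
                         (∀ i j → r i ≈ r j → i ≡ j) → ¬ (∀ i → r i ^F s ≈ r i)
  ^-fixed-points-bound (suc (suc t)) (s≤s (s≤s z≤n)) r r-inj fixed
    with _ ∷ _ ∷ monomial≈0 ← roots-bound _ r r-inj (Xˢ-X t)
                                (ℕ.≤-reflexive (cong (suc ∘ suc) (length-monomial t)))
                                (λ i → trans (eval-Xˢ-X t (r i)) (x≈y⇒x-y≈0 (fixed i)))
    = monomial≉0 t monomial≈0

module _ (F : FiniteField) where
  open FiniteField F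
  open FieldProperties F
  open import Relation.Binary.Reasoning.Setoid setoid
  open import Algebra.Solver.CommutativeMonoid *-commutativeMonoid using (solve; _⊕_; _⊜_)

  -- α₂ α₃^(q^K) ⋯ α_m^(q^((m-2)K)) α₁^(q^((m-1)K)) in the paper's 1-based indexing.
  cyclicProduct : (q K m : ℕ) .{{_ : NonZero m}} → (Fin m → Carrier) → Carrier
  cyclicProduct q K m α = prod F m (λ j → α (suc j mod m) ^F q ℕ.^ (K ℕ.* j))

  cyclicProduct≈Kelt^qᴷ*α₁^C : ∀ q K m .{{_ : NonZero m}} (α : Fin m → Carrier) → α (1 mod m) ≉ 0# →
    cyclicProduct q K m α ≈ Kelt F q K m α ^F q ℕ.^ K * α (1 mod m) ^F C q K m
  cyclicProduct≈Kelt^qᴷ*α₁^C q K (suc m′) α α₁≉0 = begin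
    prod F (suc m′) g                                ≈⟨ prod-unconsˡ m′ g ⟩
    g 0 * prod F m′ (g ∘ suc)                        ≈⟨ *-cong g₀≈a (prod-cong m′ g-suc) ⟩
    a * prod F m′ (λ j → h j ^F qᴷ)                  ≈⟨ *-congˡ (prod-^ m′ h qᴷ) ⟩
    a * Num ^F qᴷ                                    ≈⟨ *-congˡ (*-identityʳ _) ⟨
    a * (Num ^F qᴷ * 1#)                             ≈⟨ *-congˡ (*-congˡ Inv-cancels) ⟨
    a * (Num ^F qᴷ * (Inv * a ^F C′) ^F qᴷ)          ≈⟨ *-congˡ (*-congˡ (^-distrib-* Inv (a ^F C′) qᴷ)) ⟩
    a * (Num ^F qᴷ * (Inv ^F qᴷ * (a ^F C′) ^F qᴷ))  ≈⟨ regroup (Num ^F qᴷ) (Inv ^F qᴷ) ((a ^F C′) ^F qᴷ) a ⟩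
    (Num ^F qᴷ * Inv ^F qᴷ) * ((a ^F C′) ^F qᴷ * a)  ≈⟨ *-cong (^-distrib-* Num Inv qᴷ) aᶜ≈ ⟨
    (Num * Inv) ^F qᴷ * a ^F C q K (suc m′)          ∎
    where
    m = suc m′
    qᴷ = q ℕ.^ K
    a = α (1 mod m)
    C′ = C q K m′
    g h : ℕ → Carrier
    g j = α (suc j mod m) ^F q ℕ.^ (K ℕ.* j)
    h j = α ((j ℕ.+ 2) mod m) ^F q ℕ.^ (j ℕ.* K)
    -- Kelt F q K m α unfolds to Num * Inv.
    Num = prod F m′ h
    Inv = (a ^F C′) ⁻¹
    g₀≈a : g 0 ≈ a
    g₀≈a = trans (^-congʳ a (cong (q ℕ.^_) (ℕ.*-zeroʳ K))) (*-identityʳ a)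
    g-suc : ∀ j → g (suc j) ≈ h j ^F qᴷ
    g-suc j = begin
      α (suc (suc j) mod m) ^F q ℕ.^ (K ℕ.* suc j)     ≡⟨ cong₂ (λ i e → α (i mod m) ^F e) (ℕ.+-comm 2 j) exponents ⟩
      α ((j ℕ.+ 2) mod m) ^F (q ℕ.^ (j ℕ.* K) ℕ.* qᴷ)  ≈⟨ ^-assocʳ _ (q ℕ.^ (j ℕ.* K)) qᴷ ⟨
      h j ^F qᴷ                                        ∎
      where
      exponents : q ℕ.^ (K ℕ.* suc j) ≡ q ℕ.^ (j ℕ.* K) ℕ.* qᴷ
      exponents = ≡.trans (^-*-suc q K j) (≡.trans (ℕ.*-comm qᴷ _) (cong (λ e → q ℕ.^ e ℕ.* qᴷ) (ℕ.*-comm K j)))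
    Inv-cancels : (Inv * a ^F C′) ^F qᴷ ≈ 1#
    Inv-cancels = trans (^-congˡ qᴷ (inverseˡ _ (^-≉0 C′ α₁≉0))) (1^n≈1 qᴷ)
    aᶜ≈ : a ^F C q K m ≈ (a ^F C′) ^F qᴷ * a
    aᶜ≈ = begin
      a ^F C q K m               ≡⟨ cong (a ^F_) (C-suc q K m′) ⟩
      a ^F (C′ ℕ.* qᴷ ℕ.+ 1)     ≈⟨ ^-homo-* a (C′ ℕ.* qᴷ) 1 ⟩
      a ^F (C′ ℕ.* qᴷ) * a ^F 1  ≈⟨ *-cong (sym (^-assocʳ a C′ qᴷ)) (*-identityʳ a) ⟩
      (a ^F C′) ^F qᴷ * a        ∎
    regroup : ∀ x y z w → w * (x * (y * z)) ≈ (x * y) * (z * w)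
    regroup = solve 4 (λ x y z w → w ⊕ (x ⊕ (y ⊕ z)) ⊜ (x ⊕ y) ⊕ (z ⊕ w)) refl

  IsPower-cyclicProduct⇒IsPower-Kelt : ∀ q n K m .{{_ : NonZero n}} .{{_ : NonZero m}} (α : Fin m → Carrier) →
    size ≡ q ℕ.^ n → α (1 mod m) ≉ 0# →
    IsPower F (C q K m) (cyclicProduct q K m α) → IsPower F (C q K m) (Kelt F q K m α)
  IsPower-cyclicProduct⇒IsPower-Kelt q n K m α size≡qⁿ α₁≉0 =
    IsPower-^q^K⇒IsPower q n K (C q K m) size≡qⁿ
    ∘ IsPower-*-^⇒IsPower (C q K m) α₁≉0
    ∘ IsPower-resp (C q K m) (cyclicProduct≈Kelt^qᴷ*α₁^C q K m α α₁≉0)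

module Embedding (B E : FiniteField) (ι : FiniteField.Carrier B → FiniteField.Carrier E)
                 (ι-hom : IsFieldHom B E ι) where
  private
    module B = FiniteField B
    module E = FiniteField E
    module FB = FieldProperties B
    module FE = FieldProperties E
  open RingMorphisms.IsRingHomomorphism ι-hom
  open import Relation.Binary.Reasoning.Setoid E.setoid

  ι-^ : ∀ x n → ι (x B.^F n) E.≈ ι x E.^F n
  ι-^ x zero    = 1#-homo
  ι-^ x (suc n) = E.trans (*-homo x _) (E.*-congˡ (ι-^ x n))

  ι-prod : ∀ k g → ι (prod B k g) E.≈ prod E k (ι ∘ g)
  ι-prod zero    g = 1#-homo
  ι-prod (suc k) g = E.trans (*-homo _ _) (E.*-congʳ (ι-prod k g))

  ι-cyclicProduct : ∀ q K m .{{_ : NonZero m}} (α : Fin m → B.Carrier) →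
                    ι (cyclicProduct B q K m α) E.≈ cyclicProduct E q K m (ι ∘ α)
  ι-cyclicProduct q K m α = E.trans (ι-prod m _) (FE.prod-cong m (λ j → ι-^ (α _) (q ℕ.^ (K ℕ.* j))))

  ι-≉0 : ∀ {x} → x B.≉ B.0# → ι x E.≉ E.0#
  ι-≉0 {x} x≉0 ιx≈0 = E.1≉0 (begin
    E.1#                 ≈⟨ 1#-homo ⟨
    ι B.1#               ≈⟨ ⟦⟧-cong (B.inverseʳ x x≉0) ⟨
    ι (x B.* x B.⁻¹)     ≈⟨ *-homo _ _ ⟩
    ι x E.* ι (x B.⁻¹)   ≈⟨ E.*-congʳ ιx≈0 ⟩
    E.0# E.* ι (x B.⁻¹)  ≈⟨ E.zeroˡ _ ⟩
    E.0#                 ∎)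

  ι-injective : ∀ {x y} → ι x E.≈ ι y → x B.≈ y
  ι-injective {x} {y} ιx≈ιy with (x B.- y) FB.≟ B.0#
  ... | yes x-y≈0 = FB.x-y≈0⇒x≈y x y x-y≈0
  ... | no x-y≉0  = ⊥-elim (ι-≉0 x-y≉0 (begin
    ι (x B.- y)        ≈⟨ +-homo x (B.- y) ⟩
    ι x E.+ ι (B.- y)  ≈⟨ E.+-congˡ (-‿homo y) ⟩
    ι x E.- ι y        ≈⟨ FE.x≈y⇒x-y≈0 ιx≈ιy ⟩
    E.0#               ∎))

  -- ι(B) supplies |B| roots of Xˢ - X, so there is no room for another one.
  ^-fixed⇒∈image : ∀ y → y E.^F B.size E.≈ y → ∃ λ u → ι u E.≈ y
  ^-fixed⇒∈image y fixed with Fin.any? (λ i → ι (B.enum i) FE.≟ y)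
  ... | yes (i , ιeᵢ≈y) = B.enum i , ιeᵢ≈y
  ... | no y∉image      = ⊥-elim (Polynomials.^-fixed-points-bound E B.size FB.2≤size r r-inj r-fixed)
    where
    r : Fin (suc B.size) → E.Carrier
    r Fin.zero    = y
    r (Fin.suc i) = ι (B.enum i)
    r-inj : ∀ i j → r i E.≈ r j → i ≡ j
    r-inj Fin.zero    Fin.zero    _       = ≡.refl
    r-inj Fin.zero    (Fin.suc j) y≈ιeⱼ   = ⊥-elim (y∉image (j , E.sym y≈ιeⱼ))
    r-inj (Fin.suc i) Fin.zero    ιeᵢ≈y   = ⊥-elim (y∉image (i , ιeᵢ≈y))
    r-inj (Fin.suc i) (Fin.suc j) ιeᵢ≈ιeⱼ = cong Fin.suc (B.enum-inj i j (ι-injective ιeᵢ≈ιeⱼ))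
    r-fixed : ∀ i → r i E.^F B.size E.≈ r i
    r-fixed Fin.zero    = fixed
    r-fixed (Fin.suc i) = E.trans (E.sym (ι-^ (B.enum i) B.size)) (⟦⟧-cong (FB.fermat (B.enum i)))

  -- Taking norms down to B preserves c-th powers, and ℓ ≡ 1 (mod c) lets a be recovered from aˡ.
  descent : ∀ c N → E.size ≡ B.size ℕ.^ suc (N ℕ.* c) →
            ∀ {a} → FE.IsUnitPower c (ι a) → IsPower B c a
  descent c N |E|≡|B|ˡ {a} (W , W≉0 , Wᶜ≈ιa) =
    FB.IsPower-*-^⇒IsPower c (FB.^-≉0 N a≉0) (u , B.trans uᶜ≈aˡ aˡ≈a*[aᴺ]ᶜ)
    where
    ℓ = suc (N ℕ.* c)
    T = C B.size 1 ℓ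
    norm = W E.^F T
    norm∈image : ∃ λ u → ι u E.≈ norm
    norm∈image = ^-fixed⇒∈image norm (FE.^-C-fixed B.size ℓ W≉0 |E|≡|B|ˡ)
    u = proj₁ norm∈image
    a≉0 : a B.≉ B.0#
    a≉0 a≈0 = FE.^-≉0 c W≉0 (E.trans Wᶜ≈ιa (E.trans (⟦⟧-cong a≈0) 0#-homo))
    uᶜ≈aˡ : u B.^F c B.≈ a B.^F ℓ
    uᶜ≈aˡ = B.trans (ι-injective (begin
      ι (u B.^F c)       ≈⟨ ι-^ u c ⟩
      ι u E.^F c         ≈⟨ FE.^-congˡ c (proj₂ norm∈image) ⟩
      norm E.^F c        ≈⟨ FE.^-assocʳ W T c ⟩
      W E.^F (T ℕ.* c)   ≈⟨ FE.^-congʳ W (ℕ.*-comm T c) ⟩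
      W E.^F (c ℕ.* T)   ≈⟨ FE.^-assocʳ W c T ⟨
      (W E.^F c) E.^F T  ≈⟨ FE.^-congˡ T Wᶜ≈ιa ⟩
      ι a E.^F T         ≈⟨ ι-^ a T ⟨
      ι (a B.^F T)       ∎)) (FB.^-C-size a ℓ)
    aˡ≈a*[aᴺ]ᶜ : a B.^F ℓ B.≈ a B.* (a B.^F N) B.^F c
    aˡ≈a*[aᴺ]ᶜ = B.*-congˡ (B.sym (FB.^-assocʳ a N c))

  IsUnitPower-cyclicProduct⇒IsPower-Kelt :
    ∀ q n K m N .{{_ : NonZero n}} .{{_ : NonZero m}} (α : Fin m → B.Carrier) →
    B.size ≡ q ℕ.^ n → E.size ≡ B.size ℕ.^ suc (N ℕ.* C q K m) → α (1 mod m) B.≉ B.0# →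
    FE.IsUnitPower (C q K m) (cyclicProduct E q K m (ι ∘ α)) → IsPower B (C q K m) (Kelt B q K m α)
  IsUnitPower-cyclicProduct⇒IsPower-Kelt q n K m N α |B|≡qⁿ |E|≡|B|ˡ α₁≉0 (W , W≉0 , Wᶜ≈P) =
    IsPower-cyclicProduct⇒IsPower-Kelt B q n K m α |B|≡qⁿ α₁≉0
      (descent (C q K m) N |E|≡|B|ˡ (W , W≉0 , E.trans Wᶜ≈P (E.sym (ι-cyclicProduct q K m α))))

module CyclicRecurrence (F : FiniteField) (q K : ℕ) .{{_ : NonZero q}} where
  open FiniteField F
  open FieldProperties F
  open import Relation.Binary.Reasoning.Setoid setoid
  open import Algebra.Solver.CommutativeMonoid *-commutativeMonoid using (solve; _⊕_; _⊜_)

  module _ (z a : ℕ → Carrier) {c} (c≉0 : c ≉ 0#) (a≉0 : ∀ j → a j ≉ 0#)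
           (step : ∀ j → z j ≈ c * (a (suc j) * z (suc j) ^F q ℕ.^ K)) where

    P : ℕ → Carrier
    P k = prod F k (λ j → a (suc j) ^F q ℕ.^ (K ℕ.* j))

    unfold : ∀ k → z 0 ≈ c ^F C q K k * (P k * z k ^F q ℕ.^ (K ℕ.* k))
    unfold zero = begin
      z 0                                 ≈⟨ *-identityʳ (z 0) ⟨
      z 0 ^F 1                            ≡⟨ cong (λ e → z 0 ^F q ℕ.^ e) (ℕ.*-zeroʳ K) ⟨
      z 0 ^F q ℕ.^ (K ℕ.* 0)              ≈⟨ *-identityˡ _ ⟨
      1# * z 0 ^F q ℕ.^ (K ℕ.* 0)         ≈⟨ *-identityˡ _ ⟨
      1# * (1# * z 0 ^F q ℕ.^ (K ℕ.* 0))  ∎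
    unfold (suc k) = begin
      z 0                                                     ≈⟨ unfold k ⟩
      c ^F C q K k * (P k * z k ^F e)                         ≈⟨ *-congˡ (*-congˡ (^-congˡ e (step k))) ⟩
      c ^F C q K k * (P k * (c * (aₖ₊₁ * Z)) ^F e)            ≈⟨ *-congˡ (*-congˡ (^-distrib-* c _ e)) ⟩
      c ^F C q K k * (P k * (c ^F e * (aₖ₊₁ * Z) ^F e))       ≈⟨ *-congˡ (*-congˡ (*-congˡ (^-distrib-* aₖ₊₁ Z e))) ⟩
      c ^F C q K k * (P k * (c ^F e * (aₖ₊₁ ^F e * Z ^F e)))  ≈⟨ regroup (c ^F C q K k) (P k) (c ^F e) (aₖ₊₁ ^F e) (Z ^F e) ⟩
      (c ^F e * c ^F C q K k) * ((P k * aₖ₊₁ ^F e) * Z ^F e)  ≈⟨ *-cong (^-homo-* c e (C q K k)) (*-congˡ Zᵉ≈) ⟨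
      c ^F C q K (suc k) * (P (suc k) * z (suc k) ^F q ℕ.^ (K ℕ.* suc k)) ∎
      where
      e = q ℕ.^ (K ℕ.* k)
      aₖ₊₁ = a (suc k)
      Z = z (suc k) ^F q ℕ.^ K
      Zᵉ≈ : z (suc k) ^F q ℕ.^ (K ℕ.* suc k) ≈ Z ^F e
      Zᵉ≈ = sym (trans (^-assocʳ (z (suc k)) (q ℕ.^ K) e) (^-congʳ _ (≡.sym (^-*-suc q K k))))
      regroup : ∀ u v w x y → u * (v * (w * (x * y))) ≈ (w * u) * ((v * x) * y)
      regroup = solve 5 (λ u v w x y → u ⊕ (v ⊕ (w ⊕ (x ⊕ y))) ⊜ (w ⊕ u) ⊕ ((v ⊕ x) ⊕ y)) refl

    z≉0⇒z₀≉0 : ∀ k → z k ≉ 0# → z 0 ≉ 0#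
    z≉0⇒z₀≉0 zero    z₀≉0   = z₀≉0
    z≉0⇒z₀≉0 (suc k) zₖ₊₁≉0 = z≉0⇒z₀≉0 k λ zₖ≈0 →
      *-≉0 c≉0 (*-≉0 (a≉0 (suc k)) (^-≉0 (q ℕ.^ K) zₖ₊₁≉0)) (trans (sym (step k)) zₖ≈0)

    -- Once round the period, z₀ ≈ c^C P z₀^(q^(Km)) with q^(Km) = 1 + (q^K - 1) C, so z₀ cancels.
    periodic⇒IsUnitPower : ∀ m → z m ≈ z 0 → ∀ k → z k ≉ 0# → IsUnitPower (C q K m) (P m)
    periodic⇒IsUnitPower m zₘ≈z₀ k zₖ≉0 = x*yᶜ≈1⇒IsUnitPower Cₘ G≉0 (*-cancelʳ z₀≉0 (begin
      (P m * G ^F Cₘ) * z 0                       ≈⟨ *-congʳ (*-congˡ (^-distrib-* c (z 0 ^F d) Cₘ)) ⟩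
      (P m * (c ^F Cₘ * (z 0 ^F d) ^F Cₘ)) * z 0  ≈⟨ regroup (P m) (c ^F Cₘ) ((z 0 ^F d) ^F Cₘ) (z 0) ⟩
      c ^F Cₘ * (P m * ((z 0 ^F d) ^F Cₘ * z 0))  ≈⟨ *-congˡ (*-congˡ z₀^qᴷᵐ≈) ⟨
      c ^F Cₘ * (P m * z 0 ^F q ℕ.^ (K ℕ.* m))    ≈⟨ *-congˡ (*-congˡ (^-congˡ (q ℕ.^ (K ℕ.* m)) zₘ≈z₀)) ⟨
      c ^F Cₘ * (P m * z m ^F q ℕ.^ (K ℕ.* m))    ≈⟨ unfold m ⟨
      z 0                                         ≈⟨ *-identityˡ (z 0) ⟨
      1# * z 0                                    ∎))
      where
      instance _ = ℕ.m^n≢0 q K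
      d = ℕ.pred (q ℕ.^ K)
      Cₘ = C q K m
      z₀≉0 : z 0 ≉ 0#
      z₀≉0 = z≉0⇒z₀≉0 k zₖ≉0
      G = c * z 0 ^F d
      G≉0 : G ≉ 0#
      G≉0 = *-≉0 c≉0 (^-≉0 d z₀≉0)
      z₀^qᴷᵐ≈ : z 0 ^F q ℕ.^ (K ℕ.* m) ≈ (z 0 ^F d) ^F Cₘ * z 0
      z₀^qᴷᵐ≈ = begin
        z 0 ^F q ℕ.^ (K ℕ.* m)        ≡⟨ cong (z 0 ^F_) (C-telescope q K m (≡.sym (ℕ.suc-pred (q ℕ.^ K)))) ⟨
        z 0 ^F (d ℕ.* Cₘ ℕ.+ 1)       ≈⟨ ^-homo-* (z 0) (d ℕ.* Cₘ) 1 ⟩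
        z 0 ^F (d ℕ.* Cₘ) * z 0 ^F 1  ≈⟨ *-cong (sym (^-assocʳ (z 0) d Cₘ)) (*-identityʳ (z 0)) ⟩
        (z 0 ^F d) ^F Cₘ * z 0        ∎
      regroup : ∀ u v w x → (u * (v * w)) * x ≈ v * (u * (w * x))
      regroup = solve 4 (λ u v w x → (u ⊕ (v ⊕ w)) ⊕ x ⊜ v ⊕ (u ⊕ (w ⊕ x))) refl

module CyclicSystem (F : FiniteField) (q I K m : ℕ) .{{_ : NonZero q}} .{{_ : NonZero m}}
                    (α : Fin m → FiniteField.Carrier F) (α≉0 : ∀ i → FiniteField._≉_ F (α i) (FiniteField.0# F)) where
  open FiniteField F
  open FieldProperties F
  open import Relation.Binary.Reasoning.Setoid setoid

  J = I ℕ.+ K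

  σ : Fin m → Fin m
  σ i = suc (toℕ i) mod m

  f : (Fin m → Carrier) → Fin m → Carrier
  f x i = x i ^F q ℕ.^ I + α (σ i) * x (σ i) ^F q ℕ.^ J

  f-cong : ∀ {x y} → (∀ i → x i ≈ y i) → ∀ i → f x i ≈ f y i
  f-cong x≈y i = +-cong (^-congˡ (q ℕ.^ I) (x≈y i)) (*-congˡ (^-congˡ (q ℕ.^ J) (x≈y (σ i))))

  module _ (x : Fin m → Carrier) (l : Carrier) (x≢0 : ∃ λ k → x k ≉ 0#)
           (eigen : ∀ i → f (λ j → l * x j) i ≈ l * f x i) where
    private
      μ ν : Carrier
      μ = l ^F q ℕ.^ I - l
      ν = l ^F q ℕ.^ J - l
      x̂ α̂ ẑ : ℕ → Carrier
      x̂ j = x (j mod m)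
      α̂ j = α (j mod m)
      ẑ j = x̂ j ^F q ℕ.^ I
      k = proj₁ x≢0
      xₖ≉0 = proj₂ x≢0

    relation : ∀ i → μ * x i ^F q ℕ.^ I + ν * (α (σ i) * x (σ i) ^F q ℕ.^ J) ≈ 0#
    relation i = ax+bz≈cx+cz⇒[a-c]x+[b-c]z≈0 _ _ l (x i ^F q ℕ.^ I) (α (σ i) * x (σ i) ^F q ℕ.^ J) (begin
      l ^F q ℕ.^ I * x i ^F q ℕ.^ I + l ^F q ℕ.^ J * (α (σ i) * x (σ i) ^F q ℕ.^ J)  ≈⟨ lx-expanded ⟨
      f (λ j → l * x j) i                                                           ≈⟨ eigen i ⟩
      l * f x i                                                                     ≈⟨ distribˡ l _ _ ⟩
      l * x i ^F q ℕ.^ I + l * (α (σ i) * x (σ i) ^F q ℕ.^ J)                       ∎)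
      where
      lx-expanded = +-cong (^-distrib-* l (x i) (q ℕ.^ I))
                           (trans (*-congˡ (^-distrib-* l (x (σ i)) (q ℕ.^ J))) (x*yz≈y*xz _ _ _))

    relation-ℕ : ∀ j → μ * ẑ j + ν * (α̂ (suc j) * x̂ (suc j) ^F q ℕ.^ J) ≈ 0#
    relation-ℕ j = ≡.subst (λ i → μ * ẑ j + ν * (α i * x i ^F q ℕ.^ J) ≈ 0#) (suc-toℕ-mod m j) (relation (j mod m))

    fixed⊎IsUnitPower : gcd I J ≡ 1 → l ^F q ≈ l ⊎ IsUnitPower (C q K m) (cyclicProduct F q K m α)
    fixed⊎IsUnitPower gcd≡1 with μ ≟ 0# | ν ≟ 0#
    ... | yes μ≈0 | yes ν≈0 = inj₁ (^-fixed-gcd q I J gcd≡1 (x-y≈0⇒x≈y _ _ μ≈0) (x-y≈0⇒x≈y _ _ ν≈0))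
    ... | yes μ≈0 | no ν≉0  = ⊥-elim (xₖ≉0 (≡.subst (λ i → x i ≈ 0#) (mod-suc-surjective m k) (x̂-suc≈0 _)))
      where
      x̂-suc≈0 : ∀ j → x̂ (suc j) ≈ 0#
      x̂-suc≈0 j = x^n≈0⇒x≈0 (q ℕ.^ J) (x≉0∧xy≈0⇒y≈0 (α≉0 _) (x≉0∧xy≈0⇒y≈0 ν≉0
        (x≈0∧x+y≈0⇒y≈0 (x≈0⇒xy≈0 (ẑ j) μ≈0) (relation-ℕ j))))
    ... | no μ≉0  | yes ν≈0 = ⊥-elim (xₖ≉0 (≡.subst (λ i → x i ≈ 0#) (toℕ-mod-id m k) (x̂≈0 (toℕ k))))
      where
      x̂≈0 : ∀ j → x̂ j ≈ 0#
      x̂≈0 j = x^n≈0⇒x≈0 (q ℕ.^ I) (x≉0∧xy≈0⇒y≈0 μ≉0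
        (y≈0∧x+y≈0⇒x≈0 (x≈0⇒xy≈0 _ ν≈0) (relation-ℕ j)))
    ... | no μ≉0  | no ν≉0  =
      inj₂ (CyclicRecurrence.periodic⇒IsUnitPower F q K ẑ α̂ c≉0 (α≉0 ∘ (_mod m)) step
              m ẑₘ≈ẑ₀ (toℕ k) ẑₖ≉0)
      where
      c = - (μ ⁻¹ * ν)
      c≉0 : c ≉ 0#
      c≉0 = -‿≉0 (*-≉0 (⁻¹-≉0 μ≉0) ν≉0)
      step : ∀ j → ẑ j ≈ c * (α̂ (suc j) * ẑ (suc j) ^F q ℕ.^ K)
      step j = trans (ax+by≈0⇒x≈-[a⁻¹b]y μ≉0 (relation-ℕ j)) (*-congˡ (*-congˡ (begin
        x̂ (suc j) ^F q ℕ.^ J                ≡⟨ cong (x̂ (suc j) ^F_) (ℕ.^-distribˡ-+-* q I K) ⟩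
        x̂ (suc j) ^F (q ℕ.^ I ℕ.* q ℕ.^ K)  ≈⟨ ^-assocʳ (x̂ (suc j)) (q ℕ.^ I) (q ℕ.^ K) ⟨
        ẑ (suc j) ^F q ℕ.^ K                ∎)))
      ẑₘ≈ẑ₀ : ẑ m ≈ ẑ 0
      ẑₘ≈ẑ₀ = reflexive (cong (λ i → x i ^F q ℕ.^ I) (+-mod-periodic m 0))
      ẑₖ≉0 : ẑ (toℕ k) ≉ 0#
      ẑₖ≉0 = ≡.subst (λ i → x i ^F q ℕ.^ I ≉ 0#) (≡.sym (toℕ-mod-id m k)) (^-≉0 (q ℕ.^ I) xₖ≉0)

  U : (Fin m → Carrier) → Fin (m ℕ.+ m) → Carrier
  U = Uvec F q I J m α

  U-↑ˡ : ∀ x i → U x (i ↑ˡ m) ≡ x i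
  U-↑ˡ x i rewrite Fin.splitAt-↑ˡ m i m = ≡.refl

  U-↑ʳ : ∀ x i → U x (m ↑ʳ i) ≡ f x i
  U-↑ʳ x i rewrite Fin.splitAt-↑ʳ m m i = ≡.refl

  U-zero : ∀ x → (∀ i → x i ≈ 0#) → ∀ k → U x k ≈ 0#
  U-zero x x≈0 k with splitAt m k
  ... | inj₁ i = x≈0 i
  ... | inj₂ i = begin
    x i ^F q ℕ.^ I + α (σ i) * x (σ i) ^F q ℕ.^ J  ≈⟨ +-cong (0^-cong I (x≈0 i)) (*-congˡ (0^-cong J (x≈0 (σ i)))) ⟩
    0# + α (σ i) * 0#                              ≈⟨ +-identityˡ _ ⟩
    α (σ i) * 0#                                   ≈⟨ zeroʳ _ ⟩
    0#                                             ∎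
    where
    0^-cong : ∀ e {y} → y ≈ 0# → y ^F q ℕ.^ e ≈ 0#
    0^-cong e y≈0 = trans (^-congˡ (q ℕ.^ e) y≈0) (0^n≈0 (q ℕ.^ e) {{ℕ.m^n≢0 q e}})

  U-proportional : ∀ {x y l} → (∀ k → U y k ≈ l * U x k) → ∀ i → f (λ j → l * x j) i ≈ l * f x i
  U-proportional {x} {y} {l} Uy≈lUx i = begin
    f (λ j → l * x j) i  ≈⟨ f-cong (λ j → sym (y≈lx j)) i ⟩
    f y i                ≡⟨ U-↑ʳ y i ⟨
    U y (m ↑ʳ i)         ≈⟨ Uy≈lUx (m ↑ʳ i) ⟩
    l * U x (m ↑ʳ i)     ≡⟨ cong (l *_) (U-↑ʳ x i) ⟩
    l * f x i            ∎
    where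
    y≈lx : ∀ j → y j ≈ l * x j
    y≈lx j = ≡.subst₂ (λ u v → u ≈ l * v) (U-↑ˡ y j) (U-↑ˡ x j) (Uy≈lUx (j ↑ˡ m))

  module _ (no-root : ¬ IsUnitPower (C q K m) (cyclicProduct F q K m α))
           (-1∈Fq : InFq F q (- 1#)) (gcd≡1 : gcd I J ≡ 1) where

    eigenvector⇒FqDependent : ∀ {w₁ w₂ l} x → (∀ k → w₁ k ≈ U x k) →
                              (∀ i → f (λ j → l * x j) i ≈ l * f x i) →
                              (∀ k → w₂ k ≈ l * w₁ k) → FqDependent q w₁ w₂
    eigenvector⇒FqDependent x w₁≈Ux eigen w₂≈lw₁ with Fin.any? (λ k → ¬? (x k ≟ 0#))
    ... | no x≡0 = FqDependent-zeroˡ q (λ k → trans (w₁≈Ux k) (U-zero x x≈0 k))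
      where
      x≈0 : ∀ i → x i ≈ 0#
      x≈0 i = decidable-stable (x i ≟ 0#) (λ xᵢ≉0 → x≡0 (i , xᵢ≉0))
    ... | yes x≢0 with fixed⊎IsUnitPower x _ x≢0 eigen gcd≡1
    ...   | inj₁ l∈Fq = FqDependent-scalar q l∈Fq -1∈Fq w₂≈lw₁
    ...   | inj₂ root = ⊥-elim (no-root root)

    scattered : Scattered F q (m ℕ.+ m) (USet F q I J m α)
    scattered v w₁ w₂ (x , w₁≈Ux) (y , w₂≈Uy) (λ₁ , w₁≈λ₁v) (λ₂ , w₂≈λ₂v) with λ₁ ≟ 0#
    ... | yes λ₁≈0 = FqDependent-zeroˡ q λ k → trans (w₁≈λ₁v k) (x≈0⇒xy≈0 (v k) λ₁≈0)
    ... | no λ₁≉0  = eigenvector⇒FqDependent x w₁≈Ux (U-proportional Uy≈lUx) w₂≈lw₁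
      where
      w₂≈lw₁ : ∀ k → w₂ k ≈ (λ₂ * λ₁ ⁻¹) * w₁ k
      w₂≈lw₁ = proportional λ₁≉0 w₁≈λ₁v w₂≈λ₂v
      Uy≈lUx : ∀ k → U y k ≈ (λ₂ * λ₁ ⁻¹) * U x k
      Uy≈lUx k = trans (sym (w₂≈Uy k)) (trans (w₂≈lw₁ k) (*-congˡ (w₁≈Ux k)))

open import Data.Nat using (_+_; _*_; _^_; _∸_)

mainTheorem3 : (q n m I J : ℕ) .{{_ : NonZero m}} →
    IsPrimePower q → 1 ≤ n → 3 ≤ m → I < J → J < n → gcd I J ≡ 1 →
    (B : FiniteField) → FiniteField.size B ≡ q ^ n →
    (E : (ℓ : ℕ) → 1 ≤ ℓ → FiniteField) →
    (∀ ℓ h → FiniteField.size (E ℓ h) ≡ q ^ (n * ℓ)) →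
    (ι : ∀ ℓ h → FiniteField.Carrier B → FiniteField.Carrier (E ℓ h)) →
    (∀ ℓ h → IsFieldHom B (E ℓ h) (ι ℓ h)) →
    (α : Fin m → FiniteField.Carrier B) →
    (∀ i → ¬ FiniteField._≈_ B (α i) (FiniteField.0# B)) →
    ¬ IsPower B (C q (J ∸ I) m) (Kelt B q (J ∸ I) m α) →
    ∀ N → ∃ λ ℓ → N ≤ ℓ × Σ (1 ≤ ℓ) λ h →
      Scattered (E ℓ h) q (m + m) (USet (E ℓ h) q I J m (λ i → ι ℓ h (α i)))
mainTheorem3 q n m I J q-prime-power 1≤n _ I<J _ gcd[I,J]≡1 B |B|≡qⁿ E |E|≡qⁿˡ ι ι-hom α α≉0 Kelt-not-power N =
  ℓ , N≤ℓ , 1≤ℓ , ≡.subst (λ J → Scattered Eℓ q (m + m) (USet Eℓ q I J m αℓ)) I+K≡J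
    (CyclicSystem.scattered Eℓ q I K m αℓ (ι-≉0 ∘ α≉0) no-root -1∈Fq gcd[I,I+K]≡1)
  where
  instance
    _ = IsPrimePower⇒NonZero q-prime-power
    _ = ℕ.>-nonZero 1≤n
  K ℓ : ℕ
  K = J ∸ I
  ℓ = suc (N * C q K m)
  I+K≡J : I + K ≡ J
  I+K≡J = ℕ.m+[n∸m]≡n (ℕ.<⇒≤ I<J)
  1≤ℓ : 1 ≤ ℓ
  1≤ℓ = s≤s z≤n
  N≤ℓ : N ≤ ℓ
  N≤ℓ = ℕ.m≤n⇒m≤1+n (ℕ.m≤m*n N (C q K m) {{ℕ.>-nonZero (C-positive q K m)}})
  Eℓ : FiniteField
  Eℓ = E ℓ 1≤ℓ
  αℓ : Fin m → FiniteField.Carrier Eℓ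
  αℓ = ι ℓ 1≤ℓ ∘ α
  open Embedding B Eℓ (ι ℓ 1≤ℓ) (ι-hom ℓ 1≤ℓ)
  |Eℓ|≡|B|ˡ : FiniteField.size Eℓ ≡ FiniteField.size B ^ ℓ
  |Eℓ|≡|B|ˡ = ≡.trans (|E|≡qⁿˡ ℓ 1≤ℓ) (≡.trans (≡.sym (ℕ.^-*-assoc q n ℓ)) (cong (_^ ℓ) (≡.sym |B|≡qⁿ)))
  gcd[I,I+K]≡1 : gcd I (I + K) ≡ 1
  gcd[I,I+K]≡1 = ≡.subst (λ J → gcd I J ≡ 1) (≡.sym I+K≡J) gcd[I,J]≡1
  no-root : ¬ FieldProperties.IsUnitPower Eℓ (C q K m) (cyclicProduct Eℓ q K m αℓ)
  no-root = Kelt-not-power ∘ IsUnitPower-cyclicProduct⇒IsPower-Kelt q n K m N α |B|≡qⁿ |Eℓ|≡|B|ˡ (α≉0 _)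
  -1∈Fq : InFq Eℓ q (FiniteField.-_ Eℓ (FiniteField.1# Eℓ))
  -1∈Fq = FieldProperties.-1^q≈-1 Eℓ q
    (≡.subst (q ∣_) (≡.sym (|E|≡qⁿˡ ℓ 1≤ℓ)) (∣-^ q (n * ℓ) {{ℕ.m*n≢0 n ℓ}}))
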